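{- Let $G$ be a graph with maximum degree $\Delta(G)$ and minimum degree $\delta(G)$ such that $\Delta(G)\ge \delta(G)+1$. Then $C_{\delta(G)}(G)\le 2\Delta(G)-2\delta(G)+4$.
   Context: All graphs are finite, simple and undirected. For an integer $k\ge 1$, a set $S\subseteq V(G)$ is a $k$-dominating set of $G$ if every vertex of $V(G)\setminus S$ has at least $k$ neighbours in $S$. Two sets $U_1,U_2\subseteq V(G)$ form a $k$-coalition if neither $U_1$ nor $U_2$ is a $k$-dominating set of $G$, but $U_1\cup U_2$ is. A $k$-coalition partition of $G$ is a partition $\Theta$ of $V(G)$ into nonempty sets such that every set of $\Theta$ either is a $k$-dominating set of $G$ with exactly $k$ elements, or forms a $k$-coalition with some other set of $\Theta$. The $k$-coalition number $C_k(G)$ is the maximum number of sets in a $k$-coalition partition of $G$. -}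

module Defs where

open import Data.Nat using (ℕ; zero; suc; _+_; _≤_; _<_)
open import Data.Bool using (Bool; true; false; T; _∧_; _∨_)
open import Data.Fin using (Fin)
open import Data.Vec using (allFin; countᵇ)
open import Data.Product using (Σ; _×_; ∃; _,_)
open import Relation.Binary.PropositionalEquality using (_≡_)
open import Relation.Nullary using (¬_; does)
open import Data.Sum using (_⊎_)
import Data.Fin

record Graph (n : ℕ) : Set where
  field
    adj   : Fin n → Fin n → Bool
    sym   : ∀ u v → adj u v ≡ adj v u
    irrefl : ∀ v → adj v v ≡ false
open Graph public

VSet : ℕ → Set
VSet n = Fin n → Bool

#_ : ∀ {n} → (Fin n → Bool) → ℕ
#_ {n} p = countᵇ p (allFin n)

∣_∣ : ∀ {n} → VSet n → ℕ
∣ S ∣ = # S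

_∪_ : ∀ {n} → VSet n → VSet n → VSet n
(S ∪ T') v = S v ∨ T' v

deg : ∀ {n} → Graph n → Fin n → ℕ
deg G v = # (adj G v)

degIn : ∀ {n} → Graph n → VSet n → Fin n → ℕ
degIn G S v = # (λ u → adj G v u ∧ S u)

IsMaxDegree : ∀ {n} → Graph n → ℕ → Set
IsMaxDegree G Δ = (∀ v → deg G v ≤ Δ) × ∃ (λ v → deg G v ≡ Δ)

IsMinDegree : ∀ {n} → Graph n → ℕ → Set
IsMinDegree G δ = (∀ v → δ ≤ deg G v) × ∃ (λ v → deg G v ≡ δ)

IsKDom : ∀ {n} → Graph n → ℕ → VSet n → Set
IsKDom G k S = ∀ v → S v ≡ false → k ≤ degIn G S v

KCoalition : ∀ {n} → Graph n → ℕ → VSet n → VSet n → Set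
KCoalition G k U₁ U₂ = ¬ IsKDom G k U₁ × ¬ IsKDom G k U₂ × IsKDom G k (U₁ ∪ U₂)

-- A partition of V(G) into m classes, given by the class map f : Fin n → Fin m;
-- class i is the set { v | f v ≡ i }.
classOf : ∀ {n m} → (Fin n → Fin m) → Fin m → VSet n
classOf f i v = does (f v Data.Fin.≟ i)

IsKCoalitionPartition : ∀ {n} → Graph n → ℕ → (m : ℕ) → (Fin n → Fin m) → Set
IsKCoalitionPartition G k m f =
  (∀ i → ∃ (λ v → f v ≡ i)) ×
  (∀ i → (IsKDom G k (classOf f i) × ∣ classOf f i ∣ ≡ k)
         ⊎ ∃ (λ j → ¬ (i ≡ j) × KCoalition G k (classOf f i) (classOf f j)))

-- Let x be a vertex of minimum degree δ, y a neighbour of x, and X, B their classes. Since x has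
-- only δ neighbours, every set δ-dominating x from outside contains y; hence every class is X, B,
-- or a coalition partner of X or of B. For a non-dominating class W pick z ∉ W with a < δ
-- neighbours in W. Every partner of W avoiding z must supply at least δ − a further neighbours of
-- z, and deg z ≤ Δ leaves room for at most Δ − δ + 1 such classes, so at most Δ − δ + 2 classes
-- cover the partners of W. A dominating class has no partners, so if X or B dominates (or X = B)
-- this already gives Δ − δ + 4 classes. Otherwise the same count with the other class C excluded
-- as well covers C together with the partners of W, unless z has no neighbour in C, in which case
-- the partners of C avoiding z also supply δ − a neighbours of z and Δ − δ + 4 classes suffice
-- again; adding the two sides gives 2Δ − 2δ + 4.
module Submission where

open import Defs hiding (sym)
open import Data.Nat.Properties hiding (_≟_; suc-injective)
open import Algebra.Properties.CommutativeMonoid.Sum +-0-commutativeMonoid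
  using (sum-syntax; ∑-comm; ∑-distrib-+; sum-cong-≗)
open import Data.Bool using (Bool; true; false; T; _∧_; _∨_; not)
open import Data.Bool.Properties using (T-∨; T-∧; ∧-distribˡ-∨; ∧-zeroʳ) renaming (_≟_ to _≟ᵇ_)
open import Data.Empty using (⊥-elim)
open import Data.Fin using (Fin; zero; suc; _≟_)
open import Data.Fin.Properties using (¬∀⟶∃¬; all?; suc-injective)
open import Data.Nat using (ℕ; zero; suc; _+_; _∸_; _*_; _≤_; _<_; z≤n; s≤s; _≤ᵇ_; _≤?_)
open import Data.Nat.Tactic.RingSolver using (solve-∀)
open import Data.Product using (Σ; _×_; ∃; _,_; proj₁; proj₂)
open import Data.Sum using (_⊎_; inj₁; inj₂)
open import Data.Vec using (tabulate; countᵇ)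
open import Algebra.Properties.CommutativeSemigroup +-commutativeSemigroup using (interchange)
open import Function using (_∘_; Equivalence)
open import Relation.Binary.PropositionalEquality
open import Relation.Nullary using (¬_; does; yes; no; Dec)
open import Relation.Nullary.Decidable using (_→-dec_; dec-true; dec-false)

private
  variable
    k : ℕ

⟦_⟧ : Bool → ℕ
⟦ true ⟧  = 1
⟦ false ⟧ = 0

⟦⟧-∨-∧ : ∀ a b → ⟦ a ∨ b ⟧ + ⟦ a ∧ b ⟧ ≡ ⟦ a ⟧ + ⟦ b ⟧
⟦⟧-∨-∧ false b     = +-identityʳ ⟦ b ⟧
⟦⟧-∨-∧ true false  = refl
⟦⟧-∨-∧ true true   = refl

⟦⟧-mono : ∀ {a b} → (T a → T b) → ⟦ a ⟧ ≤ ⟦ b ⟧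
⟦⟧-mono {false} _        = z≤n
⟦⟧-mono {true} {true} _  = ≤-refl
⟦⟧-mono {true} {false} f = ⊥-elim (f _)

⟦⟧-reflect : ∀ {a b} → ⟦ a ⟧ ≤ ⟦ b ⟧ → T a → T b
⟦⟧-reflect {true} {true} _ _ = _

∑-mono-≤ : {g h : Fin k → ℕ} → (∀ i → g i ≤ h i) → ∑[ i < k ] g i ≤ ∑[ i < k ] h i
∑-mono-≤ {zero} _      = z≤n
∑-mono-≤ {suc k} g≤h = +-mono-≤ (g≤h zero) (∑-mono-≤ (g≤h ∘ suc))

∑-tight : {g h : Fin k → ℕ} → (∀ i → g i ≤ h i) → ∑[ i < k ] h i ≤ ∑[ i < k ] g i →
          ∀ i → h i ≤ g i
∑-tight {suc k} g≤h ∑h≤∑g zero with m≤n⇒m<n∨m≡n (g≤h zero)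
... | inj₂ g₀≡h₀ = ≤-reflexive (sym g₀≡h₀)
... | inj₁ g₀<h₀ = ⊥-elim (<⇒≱ (+-mono-<-≤ g₀<h₀ (∑-mono-≤ (g≤h ∘ suc))) ∑h≤∑g)
∑-tight {suc k} {g} {h} g≤h ∑h≤∑g (suc i) =
  ∑-tight (g≤h ∘ suc) (+-cancelˡ-≤ (h zero) _ _ (≤-trans ∑h≤∑g (+-monoˡ-≤ _ (g≤h zero)))) i

*-distribˡ-∑ : ∀ c (g : Fin k → ℕ) → c * ∑[ i < k ] g i ≡ ∑[ i < k ] (c * g i)
*-distribˡ-∑ {zero} c g  = *-zeroʳ c
*-distribˡ-∑ {suc k} c g =
  trans (*-distribˡ-+ c (g zero) _) (cong (c * g zero +_) (*-distribˡ-∑ c (g ∘ suc)))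

∑-zero : {g : Fin k → ℕ} → (∀ i → g i ≡ 0) → ∑[ i < k ] g i ≡ 0
∑-zero {zero} _      = refl
∑-zero {suc k} g≡0 = cong₂ _+_ (g≡0 zero) (∑-zero (g≡0 ∘ suc))

∑-supported-at : (j : Fin k) {g : Fin k → ℕ} → (∀ i → i ≢ j → g i ≡ 0) → ∑[ i < k ] g i ≡ g j
∑-supported-at zero {g} g≡0 =
  trans (cong (g zero +_) (∑-zero (λ i → g≡0 (suc i) λ ()))) (+-identityʳ (g zero))
∑-supported-at (suc j) g≡0 =
  cong₂ _+_ (g≡0 zero λ ()) (∑-supported-at j (λ i i≢j → g≡0 (suc i) (i≢j ∘ suc-injective)))

∑-one : ∀ k → ∑[ i < k ] 1 ≡ k
∑-one zero    = refl
∑-one (suc k) = cong suc (∑-one k)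

countᵇ-tabulate : ∀ {A : Set} (p : A → Bool) (g : Fin k → A) →
                  countᵇ p (tabulate g) ≡ ∑[ i < k ] ⟦ p (g i) ⟧
countᵇ-tabulate {zero} p g  = refl
countᵇ-tabulate {suc k} p g with p (g zero)
... | true  = cong suc (countᵇ-tabulate p (g ∘ suc))
... | false = countᵇ-tabulate p (g ∘ suc)

#≡∑ : (p : Fin k → Bool) → # p ≡ ∑[ v < k ] ⟦ p v ⟧
#≡∑ p = countᵇ-tabulate p (λ v → v)

_⊆ᵇ_ : (Fin k → Bool) → (Fin k → Bool) → Set
p ⊆ᵇ q = ∀ v → T (p v) → T (q v)

_∩_ : (Fin k → Bool) → (Fin k → Bool) → Fin k → Bool
(p ∩ q) v = p v ∧ q v

⁅_⁆ : Fin k → Fin k → Bool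
⁅ j ⁆ i = does (i ≟ j)

∈⁅⁆ : {i j : Fin k} → i ≡ j → T (⁅ j ⁆ i)
∈⁅⁆ {i = i} {j} i≡j = subst T (sym (dec-true (i ≟ j) i≡j)) _

∈⁅⁆⁻ : {i j : Fin k} → T (⁅ j ⁆ i) → i ≡ j
∈⁅⁆⁻ {i = i} {j} t with i ≟ j
... | yes i≡j = i≡j

T-not⇒¬T : ∀ {b} → T (not b) → ¬ T b
T-not⇒¬T {false} _ ()

T-∨⁺ˡ : ∀ {a b} → T a → T (a ∨ b)
T-∨⁺ˡ t = Equivalence.from T-∨ (inj₁ t)

T-∨⁺ʳ : ∀ {a b} → T b → T (a ∨ b)
T-∨⁺ʳ t = Equivalence.from T-∨ (inj₂ t)

#-cong : {p q : Fin k → Bool} → (∀ v → p v ≡ q v) → # p ≡ # q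
#-cong {p = p} {q} p≗q = trans (#≡∑ p) (trans (sum-cong-≗ (cong ⟦_⟧ ∘ p≗q)) (sym (#≡∑ q)))

#-mono : {p q : Fin k → Bool} → p ⊆ᵇ q → # p ≤ # q
#-mono {p = p} {q} p⊆q rewrite #≡∑ p | #≡∑ q = ∑-mono-≤ (λ v → ⟦⟧-mono (p⊆q v))

#-tight : {p q : Fin k → Bool} → p ⊆ᵇ q → # q ≤ # p → q ⊆ᵇ p
#-tight {p = p} {q} p⊆q #q≤#p v =
  ⟦⟧-reflect (∑-tight (λ u → ⟦⟧-mono (p⊆q u)) (subst₂ _≤_ (#≡∑ q) (#≡∑ p) #q≤#p) v)

#-∪-∩ : (p q : Fin k → Bool) → # (p ∪ q) + # (p ∩ q) ≡ # p + # q
#-∪-∩ {k} p q = begin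
  # (p ∪ q) + # (p ∩ q)
    ≡⟨ cong₂ _+_ (#≡∑ (p ∪ q)) (#≡∑ (p ∩ q)) ⟩
  ∑[ v < k ] ⟦ p v ∨ q v ⟧ + ∑[ v < k ] ⟦ p v ∧ q v ⟧
    ≡⟨ ∑-distrib-+ (λ v → ⟦ p v ∨ q v ⟧) (λ v → ⟦ p v ∧ q v ⟧) ⟨
  ∑[ v < k ] (⟦ p v ∨ q v ⟧ + ⟦ p v ∧ q v ⟧)
    ≡⟨ sum-cong-≗ (λ v → ⟦⟧-∨-∧ (p v) (q v)) ⟩
  ∑[ v < k ] (⟦ p v ⟧ + ⟦ q v ⟧)
    ≡⟨ ∑-distrib-+ (λ v → ⟦ p v ⟧) (λ v → ⟦ q v ⟧) ⟩
  ∑[ v < k ] ⟦ p v ⟧ + ∑[ v < k ] ⟦ q v ⟧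
    ≡⟨ cong₂ _+_ (#≡∑ p) (#≡∑ q) ⟨
  # p + # q
    ∎
  where open ≡-Reasoning

#-∪ : (p q : Fin k → Bool) → # (p ∪ q) ≤ # p + # q
#-∪ p q = subst (# (p ∪ q) ≤_) (#-∪-∩ p q) (m≤m+n (# (p ∪ q)) (# (p ∩ q)))

#-∪-disjoint : {p q : Fin k → Bool} → (∀ v → T (p v) → ¬ T (q v)) → # (p ∪ q) ≡ # p + # q
#-∪-disjoint {k} {p} {q} disjoint = begin
  # (p ∪ q)               ≡⟨ +-identityʳ (# (p ∪ q)) ⟨
  # (p ∪ q) + 0           ≡⟨ cong (# (p ∪ q) +_) #p∩q≡0 ⟨
  # (p ∪ q) + # (p ∩ q)   ≡⟨ #-∪-∩ p q ⟩
  # p + # q               ∎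
  where
  open ≡-Reasoning
  empty : ∀ v → ⟦ p v ∧ q v ⟧ ≡ 0
  empty v with p v in pv | q v in qv
  ... | false | _     = refl
  ... | true  | false = refl
  ... | true  | true  = ⊥-elim (disjoint v (subst T (sym pv) _) (subst T (sym qv) _))
  #p∩q≡0 : # (p ∩ q) ≡ 0
  #p∩q≡0 = trans (#≡∑ (p ∩ q)) (∑-zero empty)

#-⁅⁆ : (j : Fin k) → # ⁅ j ⁆ ≡ 1
#-⁅⁆ j = trans (#≡∑ ⁅ j ⁆) (trans (∑-supported-at j off-j) (cong ⟦_⟧ (dec-true (j ≟ j) refl)))
  where
  off-j : ∀ i → i ≢ j → ⟦ ⁅ j ⁆ i ⟧ ≡ 0
  off-j i i≢j = cong ⟦_⟧ (dec-false (i ≟ j) i≢j)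

#-⁅⁆-∪ : (j : Fin k) (p : Fin k → Bool) → # (⁅ j ⁆ ∪ p) ≤ suc (# p)
#-⁅⁆-∪ j p = subst (λ c → # (⁅ j ⁆ ∪ p) ≤ c + # p) (#-⁅⁆ j) (#-∪ ⁅ j ⁆ p)

#-empty : ∀ k → # (λ (_ : Fin k) → false) ≡ 0
#-empty k = trans (#≡∑ (λ (_ : Fin k) → false)) (∑-zero {k} (λ _ → refl))

#-pair : (i j : Fin k) → # (⁅ i ⁆ ∪ ⁅ j ⁆) ≤ 2
#-pair i j = subst (# (⁅ i ⁆ ∪ ⁅ j ⁆) ≤_) (cong₂ _+_ (#-⁅⁆ i) (#-⁅⁆ j)) (#-∪ ⁅ i ⁆ ⁅ j ⁆)

#-full : (p : Fin k → Bool) → (∀ v → T (p v)) → k ≤ # p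
#-full {k} p all-p = begin
  k                     ≡⟨ ∑-one k ⟨
  ∑[ v < k ] 1          ≤⟨ ∑-mono-≤ (λ v → ⟦⟧-mono {true} (λ _ → all-p v)) ⟩
  ∑[ v < k ] ⟦ p v ⟧    ≡⟨ #≡∑ p ⟨
  # p                   ∎
  where open ≤-Reasoning

#-nonempty : (p : Fin k → Bool) → 1 ≤ # p → ∃ λ v → T (p v)
#-nonempty p 1≤#p = ∑-nonempty p (subst (1 ≤_) (#≡∑ p) 1≤#p)
  where
  ∑-nonempty : ∀ {k} (p : Fin k → Bool) → 1 ≤ ∑[ v < k ] ⟦ p v ⟧ → ∃ λ v → T (p v)
  ∑-nonempty {suc k} p 1≤∑ with p zero in p₀
  ... | true  = zero , subst T (sym p₀) _
  ... | false with ∑-nonempty (p ∘ suc) 1≤∑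
  ... | v , t = suc v , t

module _ {n} (G : Graph n) where

  degIn-∪ : (A B : VSet n) (z : Fin n) → degIn G (A ∪ B) z ≤ degIn G A z + degIn G B z
  degIn-∪ A B z =
    subst (_≤ degIn G A z + degIn G B z) (sym (#-cong (λ v → ∧-distribˡ-∨ (adj G z v) (A v) (B v))))
          (#-∪ (λ v → adj G z v ∧ A v) (λ v → adj G z v ∧ B v))

  degIn-∪-disjoint : {A B : VSet n} → (∀ v → T (A v) → ¬ T (B v)) → ∀ z →
                     degIn G (A ∪ B) z ≡ degIn G A z + degIn G B z
  degIn-∪-disjoint {A} {B} disjoint z =
    trans (#-cong (λ v → ∧-distribˡ-∨ (adj G z v) (A v) (B v))) (#-∪-disjoint adj-disjoint)
    where
    adj-disjoint : ∀ v → T (adj G z v ∧ A v) → ¬ T (adj G z v ∧ B v)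
    adj-disjoint v tA tB =
      disjoint v (proj₂ (Equivalence.to T-∧ tA)) (proj₂ (Equivalence.to T-∧ tB))

  degIn≤deg : (A : VSet n) (z : Fin n) → degIn G A z ≤ deg G z
  degIn≤deg A z = #-mono {q = adj G z} (λ v t → proj₁ (Equivalence.to T-∧ t))

  neighbour-∈ : (D : VSet n) {x y : Fin n} → deg G x ≤ degIn G D x → T (adj G x y) → T (D y)
  neighbour-∈ D {x} {y} deg≤degIn x~y =
    proj₂ (Equivalence.to T-∧ (#-tight {p = λ v → adj G x v ∧ D v} {adj G x}
                                       (λ v t → proj₁ (Equivalence.to T-∧ t)) deg≤degIn y x~y))

module _ {n m} (G : Graph n) (f : Fin n → Fin m) where

  ∑-degIn-classOf : (q : Fin m → Bool) (z : Fin n) →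
                    ∑[ i < m ] (⟦ q i ⟧ * degIn G (classOf f i) z) ≡ degIn G (q ∘ f) z
  ∑-degIn-classOf q z = begin
    ∑[ i < m ] (⟦ q i ⟧ * degIn G (classOf f i) z)
      ≡⟨ sum-cong-≗ expand ⟩
    ∑[ i < m ] ∑[ v < n ] term i v
      ≡⟨ ∑-comm term ⟩
    ∑[ v < n ] ∑[ i < m ] term i v
      ≡⟨ sum-cong-≗ (λ v → ∑-supported-at (f v) (off-class v)) ⟩
    ∑[ v < n ] term (f v) v
      ≡⟨ sum-cong-≗ on-class ⟩
    ∑[ v < n ] ⟦ adj G z v ∧ q (f v) ⟧
      ≡⟨ #≡∑ (λ v → adj G z v ∧ q (f v)) ⟨
    degIn G (q ∘ f) z ∎
    where
    open ≡-Reasoning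
    term : Fin m → Fin n → ℕ
    term i v = ⟦ q i ⟧ * ⟦ adj G z v ∧ classOf f i v ⟧
    expand : ∀ i → ⟦ q i ⟧ * degIn G (classOf f i) z ≡ ∑[ v < n ] term i v
    expand i = trans (cong (⟦ q i ⟧ *_) (#≡∑ (λ v → adj G z v ∧ classOf f i v)))
                     (*-distribˡ-∑ ⟦ q i ⟧ (λ v → ⟦ adj G z v ∧ classOf f i v ⟧))
    off-class : ∀ v i → i ≢ f v → term i v ≡ 0
    off-class v i i≢fv = begin
      ⟦ q i ⟧ * ⟦ adj G z v ∧ does (f v ≟ i) ⟧
        ≡⟨ cong (λ b → ⟦ q i ⟧ * ⟦ adj G z v ∧ b ⟧) (dec-false (f v ≟ i) (i≢fv ∘ sym)) ⟩
      ⟦ q i ⟧ * ⟦ adj G z v ∧ false ⟧           ≡⟨ cong (λ b → ⟦ q i ⟧ * ⟦ b ⟧) (∧-zeroʳ (adj G z v)) ⟩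
      ⟦ q i ⟧ * 0                               ≡⟨ *-zeroʳ ⟦ q i ⟧ ⟩
      0                                         ∎
    weight : ∀ a b → ⟦ b ⟧ * ⟦ a ∧ true ⟧ ≡ ⟦ a ∧ b ⟧
    weight false false = refl
    weight false true  = refl
    weight true false  = refl
    weight true true   = refl
    on-class : ∀ v → term (f v) v ≡ ⟦ adj G z v ∧ q (f v) ⟧
    on-class v = trans (cong (λ b → ⟦ q (f v) ⟧ * ⟦ adj G z v ∧ b ⟧) (dec-true (f v ≟ f v) refl))
                       (weight (adj G z v) (q (f v)))

  *-#≤degIn : ∀ s (q : Fin m → Bool) (z : Fin n) →
              (∀ i → T (q i) → s ≤ degIn G (classOf f i) z) → s * # q ≤ degIn G (q ∘ f) z
  *-#≤degIn s q z heavy = begin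
    s * # q                                        ≡⟨ cong (s *_) (#≡∑ q) ⟩
    s * ∑[ i < m ] ⟦ q i ⟧                         ≡⟨ *-distribˡ-∑ s (λ i → ⟦ q i ⟧) ⟩
    ∑[ i < m ] (s * ⟦ q i ⟧)                       ≤⟨ ∑-mono-≤ weighted ⟩
    ∑[ i < m ] (⟦ q i ⟧ * degIn G (classOf f i) z) ≡⟨ ∑-degIn-classOf q z ⟩
    degIn G (q ∘ f) z                              ∎
    where
    open ≤-Reasoning
    weighted : ∀ i → s * ⟦ q i ⟧ ≤ ⟦ q i ⟧ * degIn G (classOf f i) z
    weighted i with q i in qi
    ... | false = ≤-reflexive (*-zeroʳ s)
    ... | true  = subst₂ _≤_ (sym (*-identityʳ s)) (sym (*-identityˡ (degIn G (classOf f i) z)))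
                             (heavy i (subst T (sym qi) _))

k+s≤1+s*k : ∀ {k s} → 1 ≤ k → 1 ≤ s → k + s ≤ 1 + s * k
k+s≤1+s*k {suc k} {suc s} _ _ = s≤s (begin
  k + suc s         ≡⟨ +-suc k s ⟩
  suc k + s         ≤⟨ +-monoʳ-≤ (suc k) (m≤m*n s (suc k)) ⟩
  suc k + s * suc k ∎)
  where open ≤-Reasoning

s*k+t≤Δ⇒k+[s+t]≤1+Δ : ∀ {s k t Δ} → 1 ≤ s → s * k + t ≤ Δ → s + t ≤ 1 + Δ → k + (s + t) ≤ 1 + Δ
s*k+t≤Δ⇒k+[s+t]≤1+Δ {k = zero} _ _ s+t≤1+Δ = s+t≤1+Δ
s*k+t≤Δ⇒k+[s+t]≤1+Δ {s} {suc k} {t} {Δ} 1≤s s*k+t≤Δ _ = begin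
  suc k + (s + t)   ≡⟨ +-assoc (suc k) s t ⟨
  suc k + s + t     ≤⟨ +-monoˡ-≤ t (k+s≤1+s*k (s≤s z≤n) 1≤s) ⟩
  1 + s * suc k + t ≤⟨ s≤s s*k+t≤Δ ⟩
  1 + Δ             ∎
  where open ≤-Reasoning

module CoalitionBound {n} (G : Graph n) (Δ δ : ℕ) (maxD : IsMaxDegree G Δ) (minD : IsMinDegree G δ)
                      (1≤δ : 1 ≤ δ) {m} (f : Fin n → Fin m) (P : IsKCoalitionPartition G δ m f) where

  cl : Fin m → VSet n
  cl = classOf f

  Dom : Fin m → Set
  Dom i = IsKDom G δ (cl i)

  Partner : Fin m → Fin m → Set
  Partner W i = i ≢ W × KCoalition G δ (cl i) (cl W)

  ¬Partner-of-Dom : ∀ {W i} → Dom W → ¬ Partner W i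
  ¬Partner-of-Dom domW (_ , _ , ¬domW , _) = ¬domW domW

  Near : Fin m → Fin m → Set
  Near W C = ∀ i → i ≡ W ⊎ i ≡ C ⊎ Partner W i ⊎ Partner C i

  Near-sym : ∀ {W C} → Near W C → Near C W
  Near-sym near i with near i
  ... | inj₁ i≡W                = inj₂ (inj₁ i≡W)
  ... | inj₂ (inj₁ i≡C)         = inj₁ i≡C
  ... | inj₂ (inj₂ (inj₁ pW))   = inj₂ (inj₂ (inj₂ pW))
  ... | inj₂ (inj₂ (inj₂ pC))   = inj₂ (inj₂ (inj₁ pC))

  x : Fin n
  x = proj₁ (proj₂ minD)

  deg-x : deg G x ≡ δ
  deg-x = proj₂ (proj₂ minD)

  δ≤Δ : δ ≤ Δ
  δ≤Δ = subst (_≤ Δ) deg-x (proj₁ maxD x)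

  y-adjacent : ∃ λ y → T (adj G x y)
  y-adjacent = #-nonempty (adj G x) (subst (1 ≤_) (sym deg-x) 1≤δ)

  y : Fin n
  y = proj₁ y-adjacent

  X B : Fin m
  X = f x
  B = f y

  y-∈-dominator : (D : VSet n) → IsKDom G δ D → D x ≡ false → T (D y)
  y-∈-dominator D domD x∉D =
    neighbour-∈ G D (subst (_≤ degIn G D x) (sym deg-x) (domD x x∉D)) (proj₂ y-adjacent)

  near-coalition : ∀ i j → i ≢ j → KCoalition G δ (cl i) (cl j) → f x ≢ i →
                   i ≡ B ⊎ Partner X i ⊎ Partner B i
  near-coalition i j i≢j coal x∉i with f x ≟ j
  ... | yes x∈j = inj₂ (inj₁ ((λ i≡X → x∉i (sym i≡X)) ,
                              subst (λ w → KCoalition G δ (cl i) (cl w)) (sym x∈j) coal))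
  ... | no x∉j with Equivalence.to T-∨ (y-∈-dominator (cl i ∪ cl j) (proj₂ (proj₂ coal)) x∉i∪j)
    where
    x∉i∪j : (cl i ∪ cl j) x ≡ false
    x∉i∪j = cong₂ _∨_ (dec-false (f x ≟ i) x∉i) (dec-false (f x ≟ j) x∉j)
  ... | inj₁ y∈i = inj₁ (sym (∈⁅⁆⁻ y∈i))
  ... | inj₂ y∈j = inj₂ (inj₂ ((λ i≡B → i≢j (trans i≡B (∈⁅⁆⁻ y∈j))) ,
                              subst (λ w → KCoalition G δ (cl i) (cl w)) (sym (∈⁅⁆⁻ y∈j)) coal))

  near-X-B : Near X B
  near-X-B i with f x ≟ i | proj₂ P i
  ... | yes x∈i | _                     = inj₁ (sym x∈i)
  ... | no x∉i  | inj₁ (domi , _)       =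
    inj₂ (inj₁ (sym (∈⁅⁆⁻ (y-∈-dominator (cl i) domi (dec-false (f x ≟ i) x∉i)))))
  ... | no x∉i  | inj₂ (j , i≢j , coal) = inj₂ (near-coalition i j i≢j coal x∉i)

  dominated? : ∀ W v → Dec (cl W v ≡ false → δ ≤ degIn G (cl W) v)
  dominated? W v = (cl W v ≟ᵇ false) →-dec (δ ≤? degIn G (cl W) v)

  Dom? : ∀ W → Dec (Dom W)
  Dom? W = all? (dominated? W)

  undominated : ∀ W → ¬ Dom W → ∃ λ z → cl W z ≡ false × degIn G (cl W) z < δ
  undominated W ¬domW with ¬∀⟶∃¬ n _ (dominated? W) ¬domW
  ... | z , ¬dom-z with cl W z in z∈?W
  ...   | true  = ⊥-elim (¬dom-z (λ ()))
  ...   | false = z , z∈?W , ≰⇒> (λ δ≤ → ¬dom-z (λ _ → δ≤))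

  -- At most Δ − δ + 2 classes, written without truncated subtraction.
  CoverOf : (Fin m → Set) → Set
  CoverOf S = Σ (Fin m → Bool) λ r → (# r + δ ≤ 2 + Δ) × (∀ i → S i → T (r i))

  module Deficient (W : Fin m) (z : Fin n) (z∉W : cl W z ≡ false) (a<δ : degIn G (cl W) z < δ) where

    a s : ℕ
    a = degIn G (cl W) z
    s = δ ∸ a

    1≤s : 1 ≤ s
    1≤s = m<n⇒0<n∸m a<δ

    s+a≡δ : s + a ≡ δ
    s+a≡δ = m∸n+n≡m (<⇒≤ a<δ)

    δ+0≤1+Δ : δ + 0 ≤ 1 + Δ
    δ+0≤1+Δ = ≤-trans (≤-reflexive (+-identityʳ δ)) (m≤n⇒m≤1+n δ≤Δ)

    heavy : (Fin m → Bool) → Fin m → Bool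
    heavy E i = not (E i) ∧ (s ≤ᵇ degIn G (cl i) z)

    heavy-or-excluded : ∀ E i → s ≤ degIn G (cl i) z → T (E i) ⊎ T (heavy E i)
    heavy-or-excluded E i s≤ with E i
    ... | true  = inj₁ _
    ... | false = inj₂ (≤⇒≤ᵇ s≤)

    heavy-weight : ∀ E → s * # (heavy E) + degIn G (E ∘ f) z ≤ Δ
    heavy-weight E = begin
      s * # (heavy E) + degIn G (E ∘ f) z         ≤⟨ +-monoˡ-≤ _ (*-#≤degIn G f s (heavy E) z s≤) ⟩
      degIn G (heavy E ∘ f) z + degIn G (E ∘ f) z ≡⟨ degIn-∪-disjoint G disjoint z ⟨
      degIn G ((heavy E ∘ f) ∪ (E ∘ f)) z         ≤⟨ degIn≤deg G _ z ⟩
      deg G z                                     ≤⟨ proj₁ maxD z ⟩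
      Δ                                           ∎
      where
      open ≤-Reasoning
      s≤ : ∀ i → T (heavy E i) → s ≤ degIn G (cl i) z
      s≤ i t = ≤ᵇ⇒≤ s _ (proj₂ (Equivalence.to T-∧ t))
      disjoint : ∀ v → T (heavy E (f v)) → ¬ T (E (f v))
      disjoint v t = T-not⇒¬T (proj₁ (Equivalence.to T-∧ t))

    -- Stated with the constants on the left, so that adding singleton classes is just s≤s.
    #heavy : ∀ E e → a + e ≤ degIn G (E ∘ f) z → δ + e ≤ 1 + Δ → e + (# (heavy E) + δ) ≤ 1 + Δ
    #heavy E e a+e≤ δ+e≤1+Δ = subst (_≤ 1 + Δ) rearrange
      (s*k+t≤Δ⇒k+[s+t]≤1+Δ 1≤s (≤-trans (+-monoʳ-≤ (s * #H) a+e≤) (heavy-weight E))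
                                (subst (_≤ 1 + Δ) (sym s+[a+e]≡δ+e) δ+e≤1+Δ))
      where
      #H : ℕ
      #H = # (heavy E)
      s+[a+e]≡δ+e : s + (a + e) ≡ δ + e
      s+[a+e]≡δ+e = trans (sym (+-assoc s a e)) (cong (_+ e) s+a≡δ)
      rearrange : #H + (s + (a + e)) ≡ e + (#H + δ)
      rearrange = trans (cong (#H +_) s+[a+e]≡δ+e) (trans (sym (+-assoc #H δ e)) (+-comm (#H + δ) e))

    partner-heavy : ∀ E {V i} → cl V z ≡ false → s + degIn G (cl V) z ≤ δ → Partner V i →
                    f z ≡ i ⊎ T (E i) ⊎ T (heavy E i)
    partner-heavy E {V} {i} z∉V s+c≤δ (_ , _ , _ , dom-i∪V) with f z ≟ i
    ... | yes z∈i = inj₁ z∈i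
    ... | no z∉i  = inj₂ (heavy-or-excluded E i (+-cancelʳ-≤ (degIn G (cl V) z) s _ (begin
      s + degIn G (cl V) z                      ≤⟨ s+c≤δ ⟩
      δ                                         ≤⟨ dom-i∪V z (cong₂ _∨_ (dec-false (f z ≟ i) z∉i) z∉V) ⟩
      degIn G (cl i ∪ cl V) z                   ≤⟨ degIn-∪ G (cl i) (cl V) z ⟩
      degIn G (cl i) z + degIn G (cl V) z       ∎)))
      where open ≤-Reasoning

    partner-heavy-W : ∀ E {i} → Partner W i → f z ≡ i ⊎ T (E i) ⊎ T (heavy E i)
    partner-heavy-W E = partner-heavy E z∉W (≤-reflexive s+a≡δ)

    partners-cover : CoverOf (Partner W)
    partners-cover = ⁅ f z ⁆ ∪ heavy ⁅ W ⁆ , bound , covers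
      where
      bound : # (⁅ f z ⁆ ∪ heavy ⁅ W ⁆) + δ ≤ 2 + Δ
      bound = ≤-trans (+-monoˡ-≤ δ (#-⁅⁆-∪ (f z) (heavy ⁅ W ⁆)))
                      (s≤s (#heavy ⁅ W ⁆ 0 (≤-reflexive (+-identityʳ a)) δ+0≤1+Δ))
      covers : ∀ i → Partner W i → T ((⁅ f z ⁆ ∪ heavy ⁅ W ⁆) i)
      covers i p with partner-heavy-W ⁅ W ⁆ p
      ... | inj₁ z∈i         = T-∨⁺ˡ (∈⁅⁆ (sym z∈i))
      ... | inj₂ (inj₁ i∈W)  = ⊥-elim (proj₁ p (∈⁅⁆⁻ i∈W))
      ... | inj₂ (inj₂ i-heavy) = T-∨⁺ʳ i-heavy

    module _ (C : Fin m) (W≢C : W ≢ C) where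

      c : ℕ
      c = degIn G (cl C) z

      E : Fin m → Bool
      E = ⁅ W ⁆ ∪ ⁅ C ⁆

      degIn-E : degIn G (E ∘ f) z ≡ a + c
      degIn-E = degIn-∪-disjoint G {cl W} {cl C} disjoint z
        where
        disjoint : ∀ v → T (cl W v) → ¬ T (cl C v)
        disjoint v v∈W v∈C = W≢C (trans (sym (∈⁅⁆⁻ {i = f v} v∈W)) (∈⁅⁆⁻ {i = f v} v∈C))

      excluded-partner : ∀ {i} → T (E i) → Partner W i → i ≡ C
      excluded-partner t p with Equivalence.to T-∨ t
      ... | inj₁ i∈W = ⊥-elim (proj₁ p (∈⁅⁆⁻ i∈W))
      ... | inj₂ i∈C = ∈⁅⁆⁻ i∈C

      #heavy-E : ∀ e → e ≤ c → δ + e ≤ 1 + Δ → e + (# (heavy E) + δ) ≤ 1 + Δ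
      #heavy-E e e≤c = #heavy E e (subst (a + e ≤_) (sym degIn-E) (+-monoʳ-≤ a e≤c))

      cover-if-z∈C : f z ≡ C → CoverOf (λ i → i ≡ C ⊎ Partner W i)
      cover-if-z∈C z∈C = ⁅ C ⁆ ∪ heavy E , bound , covers
        where
        bound : # (⁅ C ⁆ ∪ heavy E) + δ ≤ 2 + Δ
        bound = ≤-trans (+-monoˡ-≤ δ (#-⁅⁆-∪ C (heavy E))) (s≤s (#heavy-E 0 z≤n δ+0≤1+Δ))
        covers : ∀ i → i ≡ C ⊎ Partner W i → T ((⁅ C ⁆ ∪ heavy E) i)
        covers i (inj₁ i≡C) = T-∨⁺ˡ (∈⁅⁆ i≡C)
        covers i (inj₂ p) with partner-heavy-W E p
        ... | inj₁ z∈i            = T-∨⁺ˡ (∈⁅⁆ (trans (sym z∈i) z∈C))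
        ... | inj₂ (inj₁ i∈E)     = T-∨⁺ˡ (∈⁅⁆ (excluded-partner i∈E p))
        ... | inj₂ (inj₂ i-heavy) = T-∨⁺ʳ i-heavy

      cover-if-z-sees-C : 1 ≤ c → CoverOf (λ i → i ≡ C ⊎ Partner W i)
      cover-if-z-sees-C 1≤c = ⁅ C ⁆ ∪ (⁅ f z ⁆ ∪ heavy E) , bound , covers
        where
        bound : # (⁅ C ⁆ ∪ (⁅ f z ⁆ ∪ heavy E)) + δ ≤ 2 + Δ
        bound = ≤-trans (+-monoˡ-≤ δ (≤-trans (#-⁅⁆-∪ C _) (s≤s (#-⁅⁆-∪ (f z) (heavy E)))))
                        (s≤s (#heavy-E 1 1≤c (subst (_≤ 1 + Δ) (+-comm 1 δ) (s≤s δ≤Δ))))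
        covers : ∀ i → i ≡ C ⊎ Partner W i → T ((⁅ C ⁆ ∪ (⁅ f z ⁆ ∪ heavy E)) i)
        covers i (inj₁ i≡C) = T-∨⁺ˡ (∈⁅⁆ i≡C)
        covers i (inj₂ p) with partner-heavy-W E p
        ... | inj₁ z∈i            = T-∨⁺ʳ {a = ⁅ C ⁆ i} (T-∨⁺ˡ {b = heavy E i} (∈⁅⁆ (sym z∈i)))
        ... | inj₂ (inj₁ i∈E)     = T-∨⁺ˡ (∈⁅⁆ (excluded-partner i∈E p))
        ... | inj₂ (inj₂ i-heavy) = T-∨⁺ʳ {a = ⁅ C ⁆ i} (T-∨⁺ʳ {a = ⁅ f z ⁆ i} i-heavy)

      bound-if-z-misses-C : Near W C → f z ≢ C → c ≡ 0 → m + δ ≤ 4 + Δ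
      bound-if-z-misses-C near z∉C c≡0 =
        ≤-trans (+-monoˡ-≤ δ (≤-trans (#-full r everything) #r≤3+#H))
                (s≤s (s≤s (s≤s (#heavy-E 0 z≤n δ+0≤1+Δ))))
        where
        r : Fin m → Bool
        r = E ∪ (⁅ f z ⁆ ∪ heavy E)
        #r≤3+#H : # r ≤ 3 + # (heavy E)
        #r≤3+#H = ≤-trans (#-∪ E _) (+-mono-≤ (#-pair W C) (#-⁅⁆-∪ (f z) (heavy E)))
        s+c≤δ : s + c ≤ δ
        s+c≤δ = subst (λ c′ → s + c′ ≤ δ) (sym c≡0) (≤-trans (≤-reflexive (+-identityʳ s)) (m∸n≤m δ a))
        heavy-cover : ∀ {i} → f z ≡ i ⊎ T (E i) ⊎ T (heavy E i) → T (r i)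
        heavy-cover {i} (inj₁ z∈i)        = T-∨⁺ʳ {a = E i} (T-∨⁺ˡ {b = heavy E i} (∈⁅⁆ (sym z∈i)))
        heavy-cover (inj₂ (inj₁ i∈E))     = T-∨⁺ˡ i∈E
        heavy-cover {i} (inj₂ (inj₂ i-heavy)) = T-∨⁺ʳ {a = E i} (T-∨⁺ʳ {a = ⁅ f z ⁆ i} i-heavy)
        everything : ∀ i → T (r i)
        everything i with near i
        ... | inj₁ i≡W              = T-∨⁺ˡ (T-∨⁺ˡ {b = ⁅ C ⁆ i} (∈⁅⁆ i≡W))
        ... | inj₂ (inj₁ i≡C)       = T-∨⁺ˡ (T-∨⁺ʳ {a = ⁅ W ⁆ i} (∈⁅⁆ i≡C))
        ... | inj₂ (inj₂ (inj₁ pW)) = heavy-cover (partner-heavy-W E pW)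
        ... | inj₂ (inj₂ (inj₂ pC)) = heavy-cover (partner-heavy E (dec-false (f z ≟ C) z∉C) s+c≤δ pC)

      cover-other : Near W C → CoverOf (λ i → i ≡ C ⊎ Partner W i) ⊎ m + δ ≤ 4 + Δ
      cover-other near with f z ≟ C
      ... | yes z∈C = inj₁ (cover-if-z∈C z∈C)
      ... | no z∉C with c in c≡
      ...   | zero  = inj₂ (bound-if-z-misses-C near z∉C c≡)
      ...   | suc _ = inj₁ (cover-if-z-sees-C (subst (1 ≤_) (sym c≡) (s≤s z≤n)))

  partners-cover : ∀ W → CoverOf (Partner W)
  partners-cover W with Dom? W
  ... | yes domW = (λ _ → false) , bound , (λ i p → ⊥-elim (¬Partner-of-Dom domW p))
    where
    bound : # (λ (_ : Fin m) → false) + δ ≤ 2 + Δ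
    bound = subst (λ k → k + δ ≤ 2 + Δ) (sym (#-empty m))
                  (≤-trans δ≤Δ (m≤n+m Δ 2))
  ... | no ¬domW with undominated W ¬domW
  ...   | z , z∉W , a<δ = Deficient.partners-cover W z z∉W a<δ

  cover-other : ∀ {W C} → W ≢ C → ¬ Dom W → Near W C →
                CoverOf (λ i → i ≡ C ⊎ Partner W i) ⊎ m + δ ≤ 4 + Δ
  cover-other {W} {C} W≢C ¬domW near with undominated W ¬domW
  ... | z , z∉W , a<δ = Deficient.cover-other W z z∉W a<δ C W≢C near

  ≤-from-two-sides : m + (δ + δ) ≤ (2 + Δ) + (2 + Δ) → m ≤ (2 * Δ ∸ 2 * δ) + 4
  ≤-from-two-sides h = subst (m ≤_) rhs (m+n≤o⇒m≤o∸n m h)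
    where
    double : ∀ d → d + d ≡ 2 * d
    double = solve-∀
    regroup : ∀ d → (2 + d) + (2 + d) ≡ 2 * d + 4
    regroup = solve-∀
    rhs : (2 + Δ) + (2 + Δ) ∸ (δ + δ) ≡ (2 * Δ ∸ 2 * δ) + 4
    rhs = begin
      (2 + Δ) + (2 + Δ) ∸ (δ + δ) ≡⟨ cong₂ _∸_ (regroup Δ) (double δ) ⟩
      (2 * Δ + 4) ∸ 2 * δ          ≡⟨ +-∸-comm 4 (*-monoʳ-≤ 2 δ≤Δ) ⟩
      (2 * Δ ∸ 2 * δ) + 4          ∎
      where open ≡-Reasoning

  ≤-from-one-side : m + δ ≤ 4 + Δ → m ≤ (2 * Δ ∸ 2 * δ) + 4
  ≤-from-one-side h = ≤-from-two-sides (begin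
    m + (δ + δ)       ≡⟨ +-assoc m δ δ ⟨
    m + δ + δ         ≤⟨ +-mono-≤ h δ≤Δ ⟩
    4 + Δ + Δ         ≡⟨ regroup Δ ⟩
    (2 + Δ) + (2 + Δ) ∎)
    where
    open ≤-Reasoning
    regroup : ∀ d → 4 + d + d ≡ (2 + d) + (2 + d)
    regroup = solve-∀

  one-sided : ∀ {W C} → Near W C → (∀ {i} → Partner W i → Partner C i) → m ≤ (2 * Δ ∸ 2 * δ) + 4
  one-sided {W} {C} near W⇒C with partners-cover C
  ... | r , #r+δ≤ , covers = ≤-from-one-side
    (≤-trans (+-monoˡ-≤ δ (≤-trans (#-full _ everything) #≤2+#r)) (s≤s (s≤s #r+δ≤)))
    where
    #≤2+#r : # ((⁅ W ⁆ ∪ ⁅ C ⁆) ∪ r) ≤ 2 + # r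
    #≤2+#r = ≤-trans (#-∪ (⁅ W ⁆ ∪ ⁅ C ⁆) r) (+-monoˡ-≤ (# r) (#-pair W C))
    everything : ∀ i → T (((⁅ W ⁆ ∪ ⁅ C ⁆) ∪ r) i)
    everything i with near i
    ... | inj₁ i≡W              = T-∨⁺ˡ (T-∨⁺ˡ {b = ⁅ C ⁆ i} (∈⁅⁆ i≡W))
    ... | inj₂ (inj₁ i≡C)       = T-∨⁺ˡ (T-∨⁺ʳ {a = ⁅ W ⁆ i} (∈⁅⁆ i≡C))
    ... | inj₂ (inj₂ (inj₁ pW)) = T-∨⁺ʳ {a = (⁅ W ⁆ ∪ ⁅ C ⁆) i} (covers i (W⇒C pW))
    ... | inj₂ (inj₂ (inj₂ pC)) = T-∨⁺ʳ {a = (⁅ W ⁆ ∪ ⁅ C ⁆) i} (covers i pC)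

  two-sided : ∀ {W C} → W ≢ C → ¬ Dom W → ¬ Dom C → Near W C → m ≤ (2 * Δ ∸ 2 * δ) + 4
  two-sided W≢C ¬domW ¬domC near
    with cover-other W≢C ¬domW near | cover-other (W≢C ∘ sym) ¬domC (Near-sym near)
  ... | inj₂ h | _      = ≤-from-one-side h
  ... | inj₁ _ | inj₂ h = ≤-from-one-side h
  ... | inj₁ (r₁ , #r₁+δ≤ , covers₁) | inj₁ (r₂ , #r₂+δ≤ , covers₂) = ≤-from-two-sides (begin
    m + (δ + δ)               ≤⟨ +-monoˡ-≤ (δ + δ) #≤ ⟩
    (# r₁ + # r₂) + (δ + δ)   ≡⟨ interchange (# r₁) (# r₂) δ δ ⟩
    (# r₁ + δ) + (# r₂ + δ)   ≤⟨ +-mono-≤ #r₁+δ≤ #r₂+δ≤ ⟩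
    (2 + Δ) + (2 + Δ)         ∎)
    where
    open ≤-Reasoning
    everything : ∀ i → T ((r₁ ∪ r₂) i)
    everything i with near i
    ... | inj₁ i≡W              = T-∨⁺ʳ {a = r₁ i} (covers₂ i (inj₁ i≡W))
    ... | inj₂ (inj₁ i≡C)       = T-∨⁺ˡ (covers₁ i (inj₁ i≡C))
    ... | inj₂ (inj₂ (inj₁ pW)) = T-∨⁺ˡ (covers₁ i (inj₂ pW))
    ... | inj₂ (inj₂ (inj₂ pC)) = T-∨⁺ʳ {a = r₁ i} (covers₂ i (inj₂ pC))
    #≤ : m ≤ # r₁ + # r₂
    #≤ = ≤-trans (#-full (r₁ ∪ r₂) everything) (#-∪ r₁ r₂)

  bound : m ≤ (2 * Δ ∸ 2 * δ) + 4
  bound with Dom? X | Dom? B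
  ... | yes domX | _        = one-sided near-X-B (λ p → ⊥-elim (¬Partner-of-Dom domX p))
  ... | no _     | yes domB = one-sided (Near-sym near-X-B) (λ p → ⊥-elim (¬Partner-of-Dom domB p))
  ... | no ¬domX | no ¬domB with X ≟ B
  ...   | yes X≡B = one-sided near-X-B (subst (λ w → Partner w _) X≡B)
  ...   | no X≢B  = two-sided X≢B ¬domX ¬domB near-X-B

theorem4 : ∀ {n} (G : Graph n) (Δ δ : ℕ) → IsMaxDegree G Δ → IsMinDegree G δ → 1 ≤ δ → suc δ ≤ Δ
           → ∀ (m : ℕ) (f : Fin n → Fin m) → IsKCoalitionPartition G δ m f
           → m ≤ (2 * Δ ∸ 2 * δ) + 4
-- The argument only needs δ ≤ Δ, which holds in every graph, so the hypothesis Δ ≥ δ + 1 is unused.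
theorem4 G Δ δ maxD minD 1≤δ _ m f P = CoalitionBound.bound G Δ δ maxD minD 1≤δ f P
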